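{- The reflexive graph $\Delta_a$ of augmented simplices is univalent.
   Context: Intensional Martin-Löf type theory with $\Pi,\Sigma$, identity types, natural numbers $\mathbb{N}$. A reflexive graph $\mathcal{G}$: type $|\mathcal{G}|$, edge types $x\approx_{\mathcal{G}}y$, $\mathsf{rx}_{\mathcal{G}}(x)$; univalent if every fan $\sum_yx\approx_{\mathcal{G}}y$ is a proposition. For $n:\mathbb{N}$ let $F(n):=\sum_{i:\mathbb{N}}(i<n)$ (ordered by the order of $\mathbb{N}$). $\Delta_a$ has vertices $\mathbb{N}$, edges $m\approx n:=\sum_{f:\mathsf{Equiv}(F(m),F(n))}\mathsf{isMonotone}(f)$, and reflexivity $(\mathrm{id}_{F(n)},\text{monotonicity of the identity})$. -}

{-# OPTIONS --without-K #-}
module Defs where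

open import Level using (Level; _⊔_; suc)
open import Data.Nat using (ℕ; _<_; _≤_)
open import Data.Product using (Σ; _,_; proj₁; proj₂)
open import Relation.Binary.PropositionalEquality using (_≡_; refl)
open import Function using (id)

isContr : ∀ {a} → Set a → Set a
isContr A = Σ A λ c → (x : A) → c ≡ x

isProp : ∀ {a} → Set a → Set a
isProp A = (x y : A) → x ≡ y

fiber : ∀ {a b} {A : Set a} {B : Set b} → (A → B) → B → Set (a ⊔ b)
fiber {A = A} f y = Σ A λ x → f x ≡ y

isEquiv : ∀ {a b} {A : Set a} {B : Set b} → (A → B) → Set (a ⊔ b)
isEquiv {B = B} f = (y : B) → isContr (fiber f y)

Equiv : ∀ {a b} → Set a → Set b → Set (a ⊔ b)
Equiv A B = Σ (A → B) isEquiv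

idIsEquiv : ∀ {a} (A : Set a) → isEquiv (id {A = A})
idIsEquiv A y = (y , refl) , λ { (x , refl) → refl }

idEquiv : ∀ {a} (A : Set a) → Equiv A A
idEquiv A = id , idIsEquiv A

record ReflGraph (a b : Level) : Set (Level.suc (a ⊔ b)) where
  field
    V  : Set a
    _≈_ : V → V → Set b
    rx : (x : V) → x ≈ x

isUnivalent : ∀ {a b} → ReflGraph a b → Set (a ⊔ b)
isUnivalent G = (x : V) → isProp (Σ V λ y → x ≈ y)
  where open ReflGraph G

F : ℕ → Set
F n = Σ ℕ λ i → i < n

isMonotone : {m n : ℕ} → (F m → F n) → Set
isMonotone {m} f = (x y : F m) → proj₁ x ≤ proj₁ y → proj₁ (f x) ≤ proj₁ (f y)

_≈ₐ_ : ℕ → ℕ → Set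
m ≈ₐ n = Σ (Equiv (F m) (F n)) λ e → isMonotone (proj₁ e)

idMonotone : (n : ℕ) → isMonotone (id {A = F n})
idMonotone n x y p = p

Δₐ : ReflGraph Level.zero Level.zero
Δₐ = record { V = ℕ ; _≈_ = _≈ₐ_ ; rx = λ n → idEquiv (F n) , idMonotone n }

{-# OPTIONS --safe --without-K #-}
-- A monotone equivalence F m ≃ F n is injective, hence strictly monotone, and its
-- inverse is strictly monotone too. A strictly monotone f : F m → F n satisfies
-- i ≤ f i, so m ≤ n; applying this in both directions gives m ≡ n and f i ≡ i. An edge
-- of Δₐ is therefore determined by its endpoints, the remaining data (equivalence and
-- monotonicity proofs) being propositions under function extensionality.
module Submission where

open import Defs
open import Level using (Level; 0ℓ)
open import Axiom.Extensionality.Propositional using (Extensionality)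
open import Axiom.UniquenessOfIdentityProofs using (UIP; module Constant⇒UIP)
open import Data.Nat using (ℕ; zero; suc; _<_; _≤_; z≤n)
open import Data.Nat.Properties
  using ( ≤-refl; ≤-reflexive; ≤-trans; ≤-antisym; ≤-<-trans; <⇒≤; <⇒≱; ≰⇒>; ≤∧≢⇒<
        ; <-irrefl; ≤-irrelevant; <-irrelevant )
open import Data.Product using (_,_; proj₁; proj₂)
open import Data.Product.Properties using (Σ-≡,≡→≡)
open import Function using (_∘_; id)
open import Relation.Binary.PropositionalEquality
  using (_≡_; _≗_; refl; sym; trans; cong; subst₂)

private
  variable
    a : Level
    A B : Set a
    m n : ℕ

isProp⇒UIP : isProp A → UIP A
isProp⇒UIP A-isProp = Constant⇒UIP.≡-irrelevant (λ {x} {y} _ → A-isProp x y) (λ _ _ → refl)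

module _ (fe : Extensionality a a) where

  isContr-isProp : {A : Set a} → isProp (isContr A)
  isContr-isProp (c , h) (c′ , _) =
    Σ-≡,≡→≡ (h c′ , fe λ x → isProp⇒UIP (λ y z → trans (sym (h y)) (h z)) _ _)

  isEquiv-isProp : {A B : Set a} (f : A → B) → isProp (isEquiv f)
  isEquiv-isProp f e e′ = fe λ y → isContr-isProp (e y) (e′ y)

  Equiv-ext : {A B : Set a} {e e′ : Equiv A B} → proj₁ e ≗ proj₁ e′ → e ≡ e′
  Equiv-ext {e′ = f′ , _} f≗f′ = Σ-≡,≡→≡ (fe f≗f′ , isEquiv-isProp f′ _ _)

inverse : Equiv A B → B → A
inverse (_ , f-isEquiv) y = proj₁ (proj₁ (f-isEquiv y))

inverse-isSection : (e : Equiv A B) → proj₁ e ∘ inverse e ≗ id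
inverse-isSection (_ , f-isEquiv) y = proj₂ (proj₁ (f-isEquiv y))

inverse-isRetraction : (e : Equiv A B) → inverse e ∘ proj₁ e ≗ id
inverse-isRetraction (f , f-isEquiv) x = cong proj₁ (proj₂ (f-isEquiv (f x)) (x , refl))

Equiv-injective : (e : Equiv A B) {x y : A} → proj₁ e x ≡ proj₁ e y → x ≡ y
Equiv-injective e {x} {y} fx≡fy =
  trans (sym (inverse-isRetraction e x)) (trans (cong (inverse e) fx≡fy) (inverse-isRetraction e y))

proj₁-injective : {u v : F n} → proj₁ u ≡ proj₁ v → u ≡ v
proj₁-injective {u = i , p} {v = .i , q} refl = cong (i ,_) (<-irrelevant p q)

isMonotone-isProp : Extensionality 0ℓ 0ℓ → (f : F m → F n) → isProp (isMonotone f)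
isMonotone-isProp fe f _ _ = fe λ _ → fe λ _ → fe λ _ → ≤-irrelevant _ _

isStrictlyMonotone : (F m → F n) → Set
isStrictlyMonotone {m} f = (x y : F m) → proj₁ x < proj₁ y → proj₁ (f x) < proj₁ (f y)

isMonotone∧injective⇒isStrictlyMonotone : {f : F m → F n} → isMonotone f →
  (∀ {x y} → f x ≡ f y → x ≡ y) → isStrictlyMonotone f
isMonotone∧injective⇒isStrictlyMonotone f-mono f-inj x y x<y =
  ≤∧≢⇒< (f-mono x y (<⇒≤ x<y))
        (λ fx≡fy → <-irrefl (cong proj₁ (f-inj (proj₁-injective fx≡fy))) x<y)

section-of-isMonotone⇒isStrictlyMonotone : {f : F m → F n} {g : F n → F m} →
  isMonotone f → f ∘ g ≗ id → isStrictlyMonotone g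
section-of-isMonotone⇒isStrictlyMonotone {f = f} {g} f-mono f∘g≗id x y x<y = ≰⇒> λ gy≤gx →
  <⇒≱ x<y (subst₂ _≤_ (cong proj₁ (f∘g≗id y)) (cong proj₁ (f∘g≗id x)) (f-mono (g y) (g x) gy≤gx))

isStrictlyMonotone⇒inflationary : (f : F m → F n) → isStrictlyMonotone f →
  (x : F m) → proj₁ x ≤ proj₁ (f x)
isStrictlyMonotone⇒inflationary {m} f f-smono (i , i<m) = go i i<m
  where
  go : (i : ℕ) (i<m : i < m) → i ≤ proj₁ (f (i , i<m))
  go zero    _      = z≤n
  go (suc i) 1+i<m = ≤-<-trans (go i (<⇒≤ 1+i<m)) (f-smono (i , <⇒≤ 1+i<m) (suc i , 1+i<m) ≤-refl)

isStrictlyMonotone⇒≤ : (f : F m → F n) → isStrictlyMonotone f → m ≤ n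
isStrictlyMonotone⇒≤ {zero}  _ _       = z≤n
isStrictlyMonotone⇒≤ {suc m} f f-smono =
  ≤-<-trans (isStrictlyMonotone⇒inflationary f f-smono (m , ≤-refl)) (proj₂ (f (m , ≤-refl)))

isStrictlyMonotone∧retraction⇒fixes : (f : F m → F n) (g : F n → F m) →
  isStrictlyMonotone f → isStrictlyMonotone g → g ∘ f ≗ id →
  (x : F m) → proj₁ (f x) ≡ proj₁ x
isStrictlyMonotone∧retraction⇒fixes f g f-smono g-smono g∘f≗id x = ≤-antisym
  (≤-trans (isStrictlyMonotone⇒inflationary g g-smono (f x)) (≤-reflexive (cong proj₁ (g∘f≗id x))))
  (isStrictlyMonotone⇒inflationary f f-smono x)

module ≈ₐ-Properties {m n : ℕ} (E : m ≈ₐ n) where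

  private
    e : Equiv (F m) (F n)
    e = proj₁ E

    f : F m → F n
    f = proj₁ e

    f-mono : isMonotone f
    f-mono = proj₂ E

    f-smono : isStrictlyMonotone f
    f-smono = isMonotone∧injective⇒isStrictlyMonotone {f = f} f-mono (Equiv-injective e)

    f⁻¹-smono : isStrictlyMonotone (inverse e)
    f⁻¹-smono = section-of-isMonotone⇒isStrictlyMonotone {f = f} f-mono (inverse-isSection e)

  endpoints-≡ : m ≡ n
  endpoints-≡ = ≤-antisym (isStrictlyMonotone⇒≤ f f-smono) (isStrictlyMonotone⇒≤ (inverse e) f⁻¹-smono)

  fixes : (x : F m) → proj₁ (f x) ≡ proj₁ x
  fixes = isStrictlyMonotone∧retraction⇒fixes f (inverse e) f-smono f⁻¹-smono (inverse-isRetraction e)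

open ≈ₐ-Properties using (endpoints-≡; fixes)

≈ₐ-isProp : Extensionality 0ℓ 0ℓ → isProp (m ≈ₐ n)
≈ₐ-isProp fe E E′ = Σ-≡,≡→≡
  ( Equiv-ext fe (λ x → proj₁-injective (trans (fixes E x) (sym (fixes E′ x))))
  , isMonotone-isProp fe (proj₁ (proj₁ E′)) _ _ )

mainTheorem19 : Extensionality 0ℓ 0ℓ → isUnivalent Δₐ
mainTheorem19 fe x (y , E) (y′ , E′)
  with refl ← endpoints-≡ E | refl ← endpoints-≡ E′ = cong (x ,_) (≈ₐ-isProp fe E E′)
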